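{- Let $\Gamma$ be a set of MSO formulas, $\varphi_1,\dots,\varphi_n$ ($n\ge1$) MSO formulas and $\Phi_1,\Phi_2$ core-wMSO$(?,+)$ formulas. If $\Gamma\vdash\bigvee_{m=1}^n\varphi_m$ and $\Gamma\cup\{\varphi_m\}\vdash\Phi_1\approx\Phi_2$ for every $m\in\{1,\dots,n\}$, then $\Gamma\vdash\Phi_1\approx\Phi_2$ (in the core-wMSO$(?,+)$ proof system).
   Context: MSO formulas $\varphi$ over a finite alphabet $\Sigma$ (syntax $\top, P_a(x), x\le y, x\in X,\neg,\wedge,\forall x,\forall X$); $\Gamma\vdash\varphi$ refers to a fixed sound and complete proof system for MSO over finite nonempty words. step-wMSO over weights $R$: $\Psi::=r\mid\varphi\,?\,\Psi_1:\Psi_2$. core-wMSO$(?,+)$: $\Phi::=\mathbf{0}\mid\prod_x\Psi\mid\varphi\,?\,\Phi_1:\Phi_2\mid\Phi_1+\Phi_2$. The core-wMSO$(?,+)$ proof system derives $\Gamma\vdash\chi_1\approx\chi_2$ by: (ref), (sym), (trans); (cong?) $\Gamma\vdash\chi_1\approx\chi_1'$, $\Gamma\vdash\chi_2\approx\chi_2'$ imply $\Gamma\vdash\varphi\,?\,\chi_1:\chi_2\approx\varphi\,?\,\chi_1':\chi_2'$; (cong+) similarly for $+$; (S1)/(C6) $\Gamma\vdash\chi_1\approx\chi_2\Rightarrow\Gamma\cup\{\varphi\}\vdash\chi_1\approx\chi_2$; (S2)/(C7) $\Gamma\vdash\neg\varphi\,?\,\chi_1:\chi_2\approx\varphi\,?\,\chi_2:\chi_1$;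 (S3)/(C8) $\Gamma\vdash\varphi\Rightarrow\Gamma\vdash\varphi\,?\,\chi_1:\chi_2\approx\chi_1$; (S4)/(C9) $\Gamma\cup\{\varphi\}\vdash\chi_1\approx\chi$ and $\Gamma\cup\{\neg\varphi\}\vdash\chi_2\approx\chi\Rightarrow\Gamma\vdash\varphi\,?\,\chi_1:\chi_2\approx\chi$ (the (S) versions for step formulas, the (C) versions for core formulas); (C1) $\Gamma\vdash\Phi+\mathbf{0}\approx\Phi$; (C2) commutativity and (C3) associativity of $+$; (C4) $\Gamma\vdash\Psi_1\approx\Psi_2$ with $x$ not free in $\Gamma$ implies $\Gamma\vdash\prod_x\Psi_1\approx\prod_x\Psi_2$; (C5) $\Gamma\vdash\prod_x\Psi\approx\prod_y\Psi[y/x]$ if $y$ does not occur in $\Psi$; (C10) $\Gamma\vdash(\varphi\,?\,\Phi':\Phi'')+\Phi\approx\varphi\,?\,(\Phi'+\Phi):(\Phi''+\Phi)$. -}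

module Defs where

open import Data.Nat using (ℕ; zero; suc; _≡ᵇ_)
open import Data.Bool using (Bool; true; false; if_then_else_)
open import Data.Fin using (Fin) renaming (_≤_ to _≤ᶠ_; zero to fzero; suc to fsuc)
open import Data.Product using (_×_)
open import Data.Sum using (_⊎_)
open import Data.Unit using () renaming (⊤ to Unit)
open import Relation.Nullary using (¬_)
open import Relation.Binary.PropositionalEquality using (_≡_)

FVar : Set
FVar = ℕ

SVar : Set
SVar = ℕ

data Form (k : ℕ) : Set where
  ⊤'   : Form k
  P    : Fin k → FVar → Form k
  _≤'_ : FVar → FVar → Form k
  _∈'_ : FVar → SVar → Form k
  ¬'_  : Form k → Form k
  _∧'_ : Form k → Form k → Form k
  ∀₁   : FVar → Form k → Form k
  ∀₂   : SVar → Form k → Form k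

_∨'_ : ∀ {k} → Form k → Form k → Form k
φ ∨' ψ = ¬' ((¬' φ) ∧' (¬' ψ))

⋁ : ∀ {k n} → (Fin (suc n) → Form k) → Form k
⋁ {n = zero}  φ = φ fzero
⋁ {n = suc n} φ = φ fzero ∨' ⋁ (λ i → φ (fsuc i))

-- Semantics over finite nonempty words: a word of length suc n is
-- w : Fin (suc n) → Fin k; σ assigns positions to first-order variables,
-- τ assigns sets of positions to second-order variables.
module _ {k n : ℕ} (w : Fin (suc n) → Fin k) where
  Sat : (FVar → Fin (suc n)) → (SVar → Fin (suc n) → Bool) → Form k → Set
  Sat σ τ ⊤'        = Unit
  Sat σ τ (P a x)   = w (σ x) ≡ a
  Sat σ τ (x ≤' y)  = σ x ≤ᶠ σ y
  Sat σ τ (x ∈' X)  = τ X (σ x) ≡ true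
  Sat σ τ (¬' φ)    = ¬ Sat σ τ φ
  Sat σ τ (φ ∧' ψ)  = Sat σ τ φ × Sat σ τ ψ
  Sat σ τ (∀₁ x φ)  = (p : Fin (suc n)) →
                      Sat (λ z → if z ≡ᵇ x then p else σ z) τ φ
  Sat σ τ (∀₂ X φ)  = (S : Fin (suc n) → Bool) →
                      Sat σ (λ Z → if Z ≡ᵇ X then S else τ Z) φ

Ctx : ℕ → Set₁
Ctx k = Form k → Set

_,,_ : ∀ {k} → Ctx k → Form k → Ctx k
(Γ ,, φ) ψ = Γ ψ ⊎ ψ ≡ φ

-- The fixed sound and complete MSO proof system over finite nonempty words:
-- by soundness and completeness, Γ ⊢ φ holds iff φ is a semantic
-- consequence of Γ over all finite nonempty words and assignments.
_⊢ₘ_ : ∀ {k} → Ctx k → Form k → Set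
_⊢ₘ_ {k} Γ φ = ∀ (n : ℕ) (w : Fin (suc n) → Fin k)
  (σ : FVar → Fin (suc n)) (τ : SVar → Fin (suc n) → Bool) →
  (∀ ψ → Γ ψ → Sat w σ τ ψ) → Sat w σ τ φ

data FreeIn {k : ℕ} (x : FVar) : Form k → Set where
  fP    : ∀ {a} → FreeIn x (P a x)
  f≤ₗ   : ∀ {y} → FreeIn x (x ≤' y)
  f≤ᵣ   : ∀ {y} → FreeIn x (y ≤' x)
  f∈    : ∀ {X} → FreeIn x (x ∈' X)
  f¬    : ∀ {φ} → FreeIn x φ → FreeIn x (¬' φ)
  f∧ₗ   : ∀ {φ ψ} → FreeIn x φ → FreeIn x (φ ∧' ψ)
  f∧ᵣ   : ∀ {φ ψ} → FreeIn x ψ → FreeIn x (φ ∧' ψ)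
  f∀₁   : ∀ {y φ} → ¬ (x ≡ y) → FreeIn x φ → FreeIn x (∀₁ y φ)
  f∀₂   : ∀ {X φ} → FreeIn x φ → FreeIn x (∀₂ X φ)

NotFreeIn : ∀ {k} → FVar → Ctx k → Set
NotFreeIn x Γ = ∀ ψ → Γ ψ → ¬ FreeIn x ψ

data OccursIn {k : ℕ} (x : FVar) : Form k → Set where
  oP    : ∀ {a} → OccursIn x (P a x)
  o≤ₗ   : ∀ {y} → OccursIn x (x ≤' y)
  o≤ᵣ   : ∀ {y} → OccursIn x (y ≤' x)
  o∈    : ∀ {X} → OccursIn x (x ∈' X)
  o¬    : ∀ {φ} → OccursIn x φ → OccursIn x (¬' φ)
  o∧ₗ   : ∀ {φ ψ} → OccursIn x φ → OccursIn x (φ ∧' ψ)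
  o∧ᵣ   : ∀ {φ ψ} → OccursIn x ψ → OccursIn x (φ ∧' ψ)
  o∀₁b  : ∀ {φ} → OccursIn x (∀₁ x φ)
  o∀₁   : ∀ {y φ} → OccursIn x φ → OccursIn x (∀₁ y φ)
  o∀₂   : ∀ {X φ} → OccursIn x φ → OccursIn x (∀₂ X φ)

-- φ[y/x]: replace the free occurrences of x by y
-- (used only when y does not occur, so no capture can happen)
rn : FVar → FVar → FVar → FVar
rn y x z = if z ≡ᵇ x then y else z

_[_/_] : ∀ {k} → Form k → FVar → FVar → Form k
⊤'        [ y / x ] = ⊤'
P a z     [ y / x ] = P a (rn y x z)
(z ≤' z') [ y / x ] = rn y x z ≤' rn y x z'
(z ∈' X)  [ y / x ] = rn y x z ∈' X
(¬' φ)    [ y / x ] = ¬' (φ [ y / x ])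
(φ ∧' ψ)  [ y / x ] = (φ [ y / x ]) ∧' (ψ [ y / x ])
∀₁ z φ    [ y / x ] = if z ≡ᵇ x then ∀₁ z φ else ∀₁ z (φ [ y / x ])
∀₂ X φ    [ y / x ] = ∀₂ X (φ [ y / x ])

data Step (k : ℕ) (R : Set) : Set where
  wt     : R → Step k R
  _?ₛ_∶_ : Form k → Step k R → Step k R → Step k R

data OccursInₛ {k : ℕ} {R : Set} (x : FVar) : Step k R → Set where
  oc  : ∀ {φ Ψ₁ Ψ₂} → OccursIn x φ → OccursInₛ x (φ ?ₛ Ψ₁ ∶ Ψ₂)
  oc₁ : ∀ {φ Ψ₁ Ψ₂} → OccursInₛ x Ψ₁ → OccursInₛ x (φ ?ₛ Ψ₁ ∶ Ψ₂)
  oc₂ : ∀ {φ Ψ₁ Ψ₂} → OccursInₛ x Ψ₂ → OccursInₛ x (φ ?ₛ Ψ₁ ∶ Ψ₂)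

_[_/_]ₛ : ∀ {k R} → Step k R → FVar → FVar → Step k R
wt r           [ y / x ]ₛ = wt r
(φ ?ₛ Ψ₁ ∶ Ψ₂) [ y / x ]ₛ = (φ [ y / x ]) ?ₛ (Ψ₁ [ y / x ]ₛ) ∶ (Ψ₂ [ y / x ]ₛ)

data _⊢ₛ_≈_ {k : ℕ} {R : Set} : Ctx k → Step k R → Step k R → Set₁ where
  ref   : ∀ {Γ Ψ} → Γ ⊢ₛ Ψ ≈ Ψ
  sym   : ∀ {Γ Ψ₁ Ψ₂} → Γ ⊢ₛ Ψ₁ ≈ Ψ₂ → Γ ⊢ₛ Ψ₂ ≈ Ψ₁
  trans : ∀ {Γ Ψ₁ Ψ₂ Ψ₃} → Γ ⊢ₛ Ψ₁ ≈ Ψ₂ → Γ ⊢ₛ Ψ₂ ≈ Ψ₃ → Γ ⊢ₛ Ψ₁ ≈ Ψ₃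
  cong? : ∀ {Γ φ Ψ₁ Ψ₁' Ψ₂ Ψ₂'} → Γ ⊢ₛ Ψ₁ ≈ Ψ₁' → Γ ⊢ₛ Ψ₂ ≈ Ψ₂' →
          Γ ⊢ₛ (φ ?ₛ Ψ₁ ∶ Ψ₂) ≈ (φ ?ₛ Ψ₁' ∶ Ψ₂')
  S1    : ∀ {Γ φ Ψ₁ Ψ₂} → Γ ⊢ₛ Ψ₁ ≈ Ψ₂ → (Γ ,, φ) ⊢ₛ Ψ₁ ≈ Ψ₂
  S2    : ∀ {Γ φ Ψ₁ Ψ₂} → Γ ⊢ₛ ((¬' φ) ?ₛ Ψ₁ ∶ Ψ₂) ≈ (φ ?ₛ Ψ₂ ∶ Ψ₁)
  S3    : ∀ {Γ φ Ψ₁ Ψ₂} → Γ ⊢ₘ φ → Γ ⊢ₛ (φ ?ₛ Ψ₁ ∶ Ψ₂) ≈ Ψ₁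
  S4    : ∀ {Γ φ Ψ₁ Ψ₂ Ψ} → (Γ ,, φ) ⊢ₛ Ψ₁ ≈ Ψ → (Γ ,, (¬' φ)) ⊢ₛ Ψ₂ ≈ Ψ →
          Γ ⊢ₛ (φ ?ₛ Ψ₁ ∶ Ψ₂) ≈ Ψ

data Core (k : ℕ) (R : Set) : Set where
  𝟘      : Core k R
  ∏      : FVar → Step k R → Core k R
  _⁇_∶_  : Form k → Core k R → Core k R → Core k R
  _⊕_    : Core k R → Core k R → Core k R

data _⊢_≈_ {k : ℕ} {R : Set} : Ctx k → Core k R → Core k R → Set₁ where
  ref   : ∀ {Γ Φ} → Γ ⊢ Φ ≈ Φ
  sym   : ∀ {Γ Φ₁ Φ₂} → Γ ⊢ Φ₁ ≈ Φ₂ → Γ ⊢ Φ₂ ≈ Φ₁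
  trans : ∀ {Γ Φ₁ Φ₂ Φ₃} → Γ ⊢ Φ₁ ≈ Φ₂ → Γ ⊢ Φ₂ ≈ Φ₃ → Γ ⊢ Φ₁ ≈ Φ₃
  cong? : ∀ {Γ φ Φ₁ Φ₁' Φ₂ Φ₂'} → Γ ⊢ Φ₁ ≈ Φ₁' → Γ ⊢ Φ₂ ≈ Φ₂' →
          Γ ⊢ (φ ⁇ Φ₁ ∶ Φ₂) ≈ (φ ⁇ Φ₁' ∶ Φ₂')
  cong+ : ∀ {Γ Φ₁ Φ₁' Φ₂ Φ₂'} → Γ ⊢ Φ₁ ≈ Φ₁' → Γ ⊢ Φ₂ ≈ Φ₂' →
          Γ ⊢ (Φ₁ ⊕ Φ₂) ≈ (Φ₁' ⊕ Φ₂')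
  C1    : ∀ {Γ Φ} → Γ ⊢ (Φ ⊕ 𝟘) ≈ Φ
  C2    : ∀ {Γ Φ₁ Φ₂} → Γ ⊢ (Φ₁ ⊕ Φ₂) ≈ (Φ₂ ⊕ Φ₁)
  C3    : ∀ {Γ Φ₁ Φ₂ Φ₃} → Γ ⊢ ((Φ₁ ⊕ Φ₂) ⊕ Φ₃) ≈ (Φ₁ ⊕ (Φ₂ ⊕ Φ₃))
  C4    : ∀ {Γ x Ψ₁ Ψ₂} → Γ ⊢ₛ Ψ₁ ≈ Ψ₂ → NotFreeIn x Γ →
          Γ ⊢ ∏ x Ψ₁ ≈ ∏ x Ψ₂
  C5    : ∀ {Γ x y Ψ} → ¬ OccursInₛ y Ψ →
          Γ ⊢ ∏ x Ψ ≈ ∏ y (Ψ [ y / x ]ₛ)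
  C6    : ∀ {Γ φ Φ₁ Φ₂} → Γ ⊢ Φ₁ ≈ Φ₂ → (Γ ,, φ) ⊢ Φ₁ ≈ Φ₂
  C7    : ∀ {Γ φ Φ₁ Φ₂} → Γ ⊢ ((¬' φ) ⁇ Φ₁ ∶ Φ₂) ≈ (φ ⁇ Φ₂ ∶ Φ₁)
  C8    : ∀ {Γ φ Φ₁ Φ₂} → Γ ⊢ₘ φ → Γ ⊢ (φ ⁇ Φ₁ ∶ Φ₂) ≈ Φ₁
  C9    : ∀ {Γ φ Φ₁ Φ₂ Φ} → (Γ ,, φ) ⊢ Φ₁ ≈ Φ → (Γ ,, (¬' φ)) ⊢ Φ₂ ≈ Φ →
          Γ ⊢ (φ ⁇ Φ₁ ∶ Φ₂) ≈ Φ
  C10   : ∀ {Γ φ Φ' Φ'' Φ} →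
          Γ ⊢ ((φ ⁇ Φ' ∶ Φ'') ⊕ Φ) ≈ (φ ⁇ (Φ' ⊕ Φ) ∶ (Φ'' ⊕ Φ))

-- Let χ(Φ) be the cascade φ₁ ? Φ : (φ₂ ? Φ : … (φₙ ? Φ : 𝟘)). Under each
-- guard φₘ the hypothesis rewrites Φ₁ to Φ₂, so χ(Φ₁) ≈ χ(Φ₂); and since
-- some guard holds, (C9) and (C8) collapse χ(Φ) to Φ. As ⊢ₘ is read
-- constructively through Sat, the disjunction is only kept in the
-- double-negated form ¬¬(φₘ ∨ … ∨ φₙ), which is what survives the
-- (C9) split on ¬φₘ₋₁ and still suffices for (C8) after two uses of (C7).
module Submission where

open import Defs
open import Data.Nat using (ℕ; suc; zero)
open import Data.Fin using (Fin) renaming (zero to fzero; suc to fsuc)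
open import Data.Sum using (inj₁; inj₂)
open import Data.Product using (_,_)
open import Relation.Binary.PropositionalEquality using (refl)

⊢ₘ-assumption : ∀ {k} {Γ : Ctx k} {φ : Form k} → (Γ ,, φ) ⊢ₘ φ
⊢ₘ-assumption {φ = φ} n w σ τ ⊨Γ = ⊨Γ φ (inj₂ refl)

⊢ₘ-¬¬-intro : ∀ {k} {Γ : Ctx k} {φ : Form k} → Γ ⊢ₘ φ → Γ ⊢ₘ (¬' (¬' φ))
⊢ₘ-¬¬-intro ⊢φ n w σ τ ⊨Γ ⊭φ = ⊭φ (⊢φ n w σ τ ⊨Γ)

⊢ₘ-¬¬-disjunctive-syllogism : ∀ {k} {Γ : Ctx k} {φ ψ : Form k} →
  Γ ⊢ₘ (¬' (¬' (φ ∨' ψ))) → (Γ ,, (¬' φ)) ⊢ₘ (¬' (¬' ψ))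
⊢ₘ-¬¬-disjunctive-syllogism ⊢φ∨ψ n w σ τ ⊨Γ¬φ ⊭ψ =
  ⊢φ∨ψ n w σ τ (λ χ χ∈Γ → ⊨Γ¬φ χ (inj₁ χ∈Γ))
    (λ ⊨φ∨ψ → ⊨φ∨ψ (⊢ₘ-assumption n w σ τ ⊨Γ¬φ , ⊭ψ))

⁇-then-¬¬ : ∀ {k R} {Γ : Ctx k} {φ : Form k} {Φ Φ' : Core k R} →
  Γ ⊢ₘ (¬' (¬' φ)) → Γ ⊢ (φ ⁇ Φ ∶ Φ') ≈ Φ
⁇-then-¬¬ ⊢¬¬φ = trans (sym C7) (trans (sym C7) (C8 ⊢¬¬φ))

⁇-cong-then : ∀ {k R} {Γ : Ctx k} {φ : Form k} {Φ₁ Φ₂ Φ' : Core k R} →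
  (Γ ,, φ) ⊢ Φ₁ ≈ Φ₂ → Γ ⊢ (φ ⁇ Φ₁ ∶ Φ') ≈ (φ ⁇ Φ₂ ∶ Φ')
⁇-cong-then Φ₁≈Φ₂ =
  C9 (trans Φ₁≈Φ₂ (sym (C8 ⊢ₘ-assumption)))
     (sym (trans (sym C7) (C8 ⊢ₘ-assumption)))

cascade : ∀ {k R n} → (Fin (suc n) → Form k) → Core k R → Core k R → Core k R
cascade {n = zero}  φ Φ Φ' = φ fzero ⁇ Φ ∶ Φ'
cascade {n = suc n} φ Φ Φ' = φ fzero ⁇ Φ ∶ cascade (λ i → φ (fsuc i)) Φ Φ'

cascade-cong : ∀ {k R n} {Γ : Ctx k} (φ : Fin (suc n) → Form k)
  {Φ₁ Φ₂ Φ' : Core k R} →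
  (∀ m → (Γ ,, φ m) ⊢ Φ₁ ≈ Φ₂) →
  Γ ⊢ cascade φ Φ₁ Φ' ≈ cascade φ Φ₂ Φ'
cascade-cong {n = zero}  φ Φ₁≈Φ₂ = ⁇-cong-then (Φ₁≈Φ₂ fzero)
cascade-cong {n = suc n} φ Φ₁≈Φ₂ =
  trans (cong? ref (cascade-cong (λ i → φ (fsuc i)) (λ m → Φ₁≈Φ₂ (fsuc m))))
        (⁇-cong-then (Φ₁≈Φ₂ fzero))

cascade-collapse : ∀ {k R n} {Γ : Ctx k} (φ : Fin (suc n) → Form k)
  {Φ Φ' : Core k R} →
  Γ ⊢ₘ (¬' (¬' ⋁ φ)) → Γ ⊢ cascade φ Φ Φ' ≈ Φ
cascade-collapse {n = zero}  φ ⊢⋁φ = ⁇-then-¬¬ ⊢⋁φ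
cascade-collapse {n = suc n} φ ⊢⋁φ =
  C9 ref (cascade-collapse (λ i → φ (fsuc i)) (⊢ₘ-¬¬-disjunctive-syllogism ⊢⋁φ))

lemma8 : ∀ {k : ℕ} {R : Set} (Γ : Ctx k) (n : ℕ) (φ : Fin (suc n) → Form k)
    (Φ₁ Φ₂ : Core k R) →
    Γ ⊢ₘ ⋁ φ →
    (∀ (m : Fin (suc n)) → (Γ ,, φ m) ⊢ Φ₁ ≈ Φ₂) →
    Γ ⊢ Φ₁ ≈ Φ₂
lemma8 Γ n φ Φ₁ Φ₂ ⊢⋁φ Φ₁≈Φ₂ =
  trans (sym (cascade-collapse φ ⊢¬¬⋁φ))
    (trans (cascade-cong φ {Φ' = 𝟘} Φ₁≈Φ₂) (cascade-collapse φ ⊢¬¬⋁φ))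
  where
  ⊢¬¬⋁φ : Γ ⊢ₘ (¬' (¬' ⋁ φ))
  ⊢¬¬⋁φ = ⊢ₘ-¬¬-intro ⊢⋁φ
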